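{- For every $n\ge1$, there is a bijection between the intervals of $\mathbb{F}_n^2$ and the bicolored Motzkin paths of length $n-1$ avoiding the seven patterns $F_2F_2,\ F_2D,\ F_2U,\ DF_2,\ UF_2,\ UU,\ DD$.
   Context: A Dyck path of semilength $n\ge 0$ is a lattice path from $(0,0)$ to $(2n,0)$ with steps $U=(1,1)$ and $D=(1,-1)$ that never goes below the $x$-axis; it is identified with its word over $\{U,D\}$. A path (or word) avoids a pattern $\alpha$ if $\alpha$ does not occur as a factor (block of consecutive steps). $\mathcal{F}_n^2$ is the set of Dyck paths of semilength $n$ avoiding $DUU$ and $DDD$, ordered by the Stanley order: $P\le Q$ iff $P$ lies weakly below $Q$ when both are drawn in the plane; $\mathbb{F}_n^2=(\mathcal{F}_n^2,\le)$. An interval is a set $[P,Q]=\{R:P\le R\le Q\}$ with $P\le Q$. A bicolored Motzkin path of length $m$ is a lattice path in the quarter plane $\{y\ge0\}$ starting at $(0,0)$, consisting of $m$ steps each among $U=(1,1)$, $D=(1,-1)$, $F_1=(1,0)$, $F_2=(1,0)$ (two distinguishable kinds of flat steps), with arbitrary endpoint height; it is identified with its word over $\{U,D,F_1,F_2\}$. -}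

module Defs where

open import Data.Bool using (Bool; true; false; _∧_; _∨_; not; T)
open import Data.Nat using (ℕ; zero; suc; _*_)
open import Data.Integer using (ℤ; +_; _+_; -_; 1ℤ; 0ℤ) renaming (_≤ᵇ_ to _≤ℤᵇ_)
open import Data.List using (List; []; _∷_; length)
open import Data.Product using (Σ; _×_; _,_)
open import Relation.Binary.PropositionalEquality using (_≡_)

isPrefixᵇ : {A : Set} → (A → A → Bool) → List A → List A → Bool
isPrefixᵇ eq []       _        = true
isPrefixᵇ eq (x ∷ p) []       = false
isPrefixᵇ eq (x ∷ p) (y ∷ w)  = eq x y ∧ isPrefixᵇ eq p w

occursᵇ : {A : Set} → (A → A → Bool) → List A → List A → Bool
occursᵇ eq p []        = isPrefixᵇ eq p []
occursᵇ eq p (y ∷ w)   = isPrefixᵇ eq p (y ∷ w) ∨ occursᵇ eq p w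

avoidsAllᵇ : {A : Set} → (A → A → Bool) → List (List A) → List A → Bool
avoidsAllᵇ eq []       w = true
avoidsAllᵇ eq (p ∷ ps) w = not (occursᵇ eq p w) ∧ avoidsAllᵇ eq ps w

data Step : Set where
  U D : Step

eqStep : Step → Step → Bool
eqStep U U = true
eqStep D D = true
eqStep _ _ = false

dyckFromᵇ : ℕ → List Step → Bool
dyckFromᵇ zero    []      = true
dyckFromᵇ (suc h) []      = false
dyckFromᵇ h       (U ∷ w) = dyckFromᵇ (suc h) w
dyckFromᵇ zero    (D ∷ w) = false
dyckFromᵇ (suc h) (D ∷ w) = dyckFromᵇ h w

lengthIsᵇ : {A : Set} → ℕ → List A → Bool
lengthIsᵇ zero    []      = true
lengthIsᵇ zero    (_ ∷ _) = false
lengthIsᵇ (suc n) []      = false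
lengthIsᵇ (suc n) (_ ∷ w) = lengthIsᵇ n w

isF2ᵇ : ℕ → List Step → Bool
isF2ᵇ n w = lengthIsᵇ (2 * n) w ∧ dyckFromᵇ 0 w
            ∧ avoidsAllᵇ eqStep ((D ∷ U ∷ U ∷ []) ∷ (D ∷ D ∷ D ∷ []) ∷ []) w

F2 : ℕ → Set
F2 n = Σ (List Step) (λ w → T (isF2ᵇ n w))

stepVal : Step → ℤ
stepVal U = 1ℤ
stepVal D = - 1ℤ

heightsFrom : ℤ → List Step → List ℤ
heightsFrom h []      = []
heightsFrom h (s ∷ w) = (h + stepVal s) ∷ heightsFrom (h + stepVal s) w

pointwiseLeᵇ : List ℤ → List ℤ → Bool
pointwiseLeᵇ (x ∷ xs) (y ∷ ys) = (x ≤ℤᵇ y) ∧ pointwiseLeᵇ xs ys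
pointwiseLeᵇ _        _        = true

stanleyLeᵇ : List Step → List Step → Bool
stanleyLeᵇ P Q = pointwiseLeᵇ (heightsFrom 0ℤ P) (heightsFrom 0ℤ Q)

_≤St_ : {n : ℕ} → F2 n → F2 n → Set
(P , _) ≤St (Q , _) = T (stanleyLeᵇ P Q)

-- intervals [P,Q] of 𝔽ₙ², identified with the pairs (P,Q) with P ≤ Q
Interval : ℕ → Set
Interval n = Σ (F2 n × F2 n) (λ { (P , Q) → _≤St_ {n} P Q })

data MStep : Set where
  MU MD F₁ F₂ : MStep

eqMStep : MStep → MStep → Bool
eqMStep MU MU = true
eqMStep MD MD = true
eqMStep F₁ F₁ = true
eqMStep F₂ F₂ = true
eqMStep _  _  = false

-- path from height h never goes below 0 (arbitrary endpoint)
motzFromᵇ : ℕ → List MStep → Bool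
motzFromᵇ h       []       = true
motzFromᵇ h       (MU ∷ w) = motzFromᵇ (suc h) w
motzFromᵇ zero    (MD ∷ w) = false
motzFromᵇ (suc h) (MD ∷ w) = motzFromᵇ h w
motzFromᵇ h       (F₁ ∷ w) = motzFromᵇ h w
motzFromᵇ h       (F₂ ∷ w) = motzFromᵇ h w

motzPatterns : List (List MStep)
motzPatterns = (F₂ ∷ F₂ ∷ []) ∷ (F₂ ∷ MD ∷ []) ∷ (F₂ ∷ MU ∷ []) ∷ (MD ∷ F₂ ∷ [])
             ∷ (MU ∷ F₂ ∷ []) ∷ (MU ∷ MU ∷ []) ∷ (MD ∷ MD ∷ []) ∷ []

isMotzᵇ : ℕ → List MStep → Bool
isMotzᵇ m w = lengthIsᵇ m w ∧ motzFromᵇ 0 w ∧ avoidsAllᵇ eqMStep motzPatterns w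

Motz : ℕ → Set
Motz m = Σ (List MStep) (λ w → T (isMotzᵇ m w))

-- A path of 𝓕ₙ² avoids DUU, so after its first D every U is immediately followed by D: the path is
-- U^(k+1) D followed by blocks U D and D, where k, the height after the first D, is the number of D
-- blocks, and avoiding DDD means that no two D blocks are adjacent. So 𝓕ₙ² is coded by the bit
-- lists of length n − 1 without two consecutive falses (true = U D, false = D).
-- A Dyck path lies below another iff, for every i, its i-th D comes no later than the i-th D of the
-- other, and in a coded path the i-th D (counting from 0) is at position 1 + 2i + (number of D
-- blocks after it). Hence P ≤ Q iff on every suffix the code of P has at most as many D blocks as
-- that of Q. Reading both codes from the right and pairing their bits as (lower, upper), with
-- U = (UD, D), D = (D, UD), F₁ = (UD, UD), F₂ = (D, D), gives a bicoloured Motzkin path whose height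
-- is the difference of these counts; the seven forbidden factors say exactly that neither code has
-- two consecutive D blocks.
{-# OPTIONS --safe #-}
module Submission where

open import Defs
open import Algebra.Bundles using (CommutativeMonoid)
open import Data.Bool using (Bool; true; false; _∧_; _∨_; not; T; if_then_else_)
open import Data.Bool.ListAction using (all)
open import Data.Bool.Properties
  using (T-≡; T-not-≡; T-∧; T-irrelevant; ∧-comm; ∧-assoc; ∧-identityʳ; ∧-zeroʳ; ∨-comm; not-involutive;
         ⇔→≡; ∨-∧-booleanAlgebra; ∧-commutativeMonoid)
open import Algebra.Lattice.Properties.BooleanAlgebra ∨-∧-booleanAlgebra using (deMorgan₂)
open import Algebra.Properties.CommutativeSemigroup
  (CommutativeMonoid.commutativeSemigroup ∧-commutativeMonoid) using () renaming (interchange to ∧-interchange)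
open import Data.Empty using (⊥-elim)
open import Data.Integer as ℤ using (+_; -_; 0ℤ; 1ℤ)
import Data.Integer.Properties as ℤP
import Data.Integer.Tactic.RingSolver as ℤ-Solver
open import Data.List
  using (List; []; _∷_; _++_; _ʳ++_; map; drop; length; replicate; reverse; zipWith; unzipWith)
open import Data.List.Properties
  using (length-reverse; drop-map; drop-[]; reverse-involutive;
         length-unzipWith₁; length-unzipWith₂; unzipWith-zipWith; zipWith-unzipWith)
open import Data.Nat using (ℕ; zero; suc; _+_; _*_; _≤_; _∸_)
open import Data.Nat.Properties using (+-suc; +-identityʳ; *-suc; suc-injective; *-cancelˡ-≡)
open import Data.Product using (Σ; _×_; _,_; proj₁; proj₂; uncurry′)
open import Function using (_∘_; _↔_; _⤖_; _⇔_; mk⇔; mk↔ₛ′; Equivalence)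
open import Function.Construct.Composition using (_⇔-∘_)
open import Function.Construct.Symmetry using (⇔-sym)
open import Function.Properties.Inverse using (↔-sym; ↔-trans; ↔⇒⤖)
open import Relation.Binary.PropositionalEquality

T-∧⁻ : ∀ a {b} → T (a ∧ b) → T a × T b
T-∧⁻ true t = _ , t

∧-true-head : ∀ {a b c} → a ≡ true → b ≡ c → a ∧ b ≡ c
∧-true-head refl b≡c = b≡c

∧-false-head : ∀ {a b} → a ≡ false → a ∧ b ≡ false
∧-false-head refl = refl

infix 5 _≤ᵇ_ _≤*ᵇ_

-- Unlike the builtin Data.Nat._≤ᵇ_, this one computes on open terms.
_≤ᵇ_ : ℕ → ℕ → Bool
zero  ≤ᵇ _     = true
suc m ≤ᵇ zero  = false
suc m ≤ᵇ suc n = m ≤ᵇ n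

≤ᵇ-+ˡ : ∀ k m n → (k + m ≤ᵇ k + n) ≡ (m ≤ᵇ n)
≤ᵇ-+ˡ zero    m n = refl
≤ᵇ-+ˡ (suc k) m n = ≤ᵇ-+ˡ k m n

m≤ᵇk+m : ∀ k m → (m ≤ᵇ k + m) ≡ true
m≤ᵇk+m k zero    = refl
m≤ᵇk+m k (suc m) = trans (cong (suc m ≤ᵇ_) (+-suc k m)) (m≤ᵇk+m k m)

1+n≰ᵇn : ∀ n → (suc n ≤ᵇ n) ≡ false
1+n≰ᵇn zero    = refl
1+n≰ᵇn (suc n) = 1+n≰ᵇn n

-- Compares only the common prefix; all uses below compare lists of equal length.
_≤*ᵇ_ : List ℕ → List ℕ → Bool
(x ∷ xs) ≤*ᵇ (y ∷ ys) = (x ≤ᵇ y) ∧ (xs ≤*ᵇ ys)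
_        ≤*ᵇ _        = true

≤*ᵇ-[] : ∀ xs → xs ≤*ᵇ [] ≡ true
≤*ᵇ-[] []      = refl
≤*ᵇ-[] (_ ∷ _) = refl

≤*ᵇ-map-suc : ∀ xs ys → map suc xs ≤*ᵇ map suc ys ≡ xs ≤*ᵇ ys
≤*ᵇ-map-suc []       ys       = refl
≤*ᵇ-map-suc (x ∷ xs) []       = refl
≤*ᵇ-map-suc (x ∷ xs) (y ∷ ys) = cong ((x ≤ᵇ y) ∧_) (≤*ᵇ-map-suc xs ys)

≤*ᵇ-ʳ++ : ∀ xs ys {xs′ ys′} → length xs ≡ length ys →
          (xs ʳ++ xs′) ≤*ᵇ (ys ʳ++ ys′) ≡ (xs ≤*ᵇ ys) ∧ (xs′ ≤*ᵇ ys′)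
≤*ᵇ-ʳ++ []       []       _ = refl
≤*ᵇ-ʳ++ (x ∷ xs) (y ∷ ys) {xs′} {ys′} eq = begin
  (xs ʳ++ x ∷ xs′) ≤*ᵇ (ys ʳ++ y ∷ ys′)      ≡⟨ ≤*ᵇ-ʳ++ xs ys (suc-injective eq) ⟩
  (xs ≤*ᵇ ys) ∧ ((x ≤ᵇ y) ∧ (xs′ ≤*ᵇ ys′))  ≡⟨ sym (∧-assoc (xs ≤*ᵇ ys) (x ≤ᵇ y) _) ⟩
  ((xs ≤*ᵇ ys) ∧ (x ≤ᵇ y)) ∧ (xs′ ≤*ᵇ ys′)  ≡⟨ cong (_∧ (xs′ ≤*ᵇ ys′)) (∧-comm (xs ≤*ᵇ ys) (x ≤ᵇ y)) ⟩
  ((x ≤ᵇ y) ∧ (xs ≤*ᵇ ys)) ∧ (xs′ ≤*ᵇ ys′)  ∎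
  where open ≡-Reasoning

≤*ᵇ-reverse : ∀ xs ys → length xs ≡ length ys → reverse xs ≤*ᵇ reverse ys ≡ xs ≤*ᵇ ys
≤*ᵇ-reverse xs ys eq = trans (≤*ᵇ-ʳ++ xs ys eq) (∧-identityʳ (xs ≤*ᵇ ys))

-- The Stanley order and the positions of the down steps

-- belowᵇ g X Y runs X and Y in parallel while Y is 2g higher than X, and fails if X overtakes Y.
belowᵇ : ℕ → List Step → List Step → Bool
belowᵇ g       (U ∷ X) (U ∷ Y) = belowᵇ g X Y
belowᵇ g       (D ∷ X) (D ∷ Y) = belowᵇ g X Y
belowᵇ g       (D ∷ X) (U ∷ Y) = belowᵇ (suc g) X Y
belowᵇ zero    (U ∷ X) (D ∷ Y) = false
belowᵇ (suc g) (U ∷ X) (D ∷ Y) = belowᵇ g X Y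
belowᵇ g       _       _       = true

private
  ≤ℤᵇ-gap : ∀ x {y} g → y ≡ x ℤ.+ + g ℤ.+ + g → (x ℤ.≤ᵇ y) ≡ true
  ≤ℤᵇ-gap x g refl =
    Equivalence.to T-≡ (ℤP.≤⇒≤ᵇ (ℤP.≤-trans (ℤP.i≤i+j x (+ g)) (ℤP.i≤i+j (x ℤ.+ + g) (+ g))))

  ≰ℤᵇ-gap : ∀ x y → x ≡ y ℤ.+ 1ℤ ℤ.+ 1ℤ → (x ℤ.≤ᵇ y) ≡ false
  ≰ℤᵇ-gap x y refl with x ℤ.≤ᵇ y in x≤ᵇy
  ... | false = refl
  ... | true  = ⊥-elim (ℤP.<-irrefl refl (ℤP.≤-<-trans (ℤP.≤ᵇ⇒≤ (Equivalence.from T-≡ x≤ᵇy)) y<x))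
    where
    y<x : y ℤ.< y ℤ.+ 1ℤ ℤ.+ 1ℤ
    y<x = ℤP.suc[i]≤j⇒i<j (subst (ℤ._≤ y ℤ.+ 1ℤ ℤ.+ 1ℤ) (ℤP.+-comm y 1ℤ) (ℤP.i≤i+j (y ℤ.+ 1ℤ) 1ℤ))

  gap-UU : ∀ a k → a ℤ.+ k ℤ.+ k ℤ.+ 1ℤ ≡ (a ℤ.+ 1ℤ) ℤ.+ k ℤ.+ k
  gap-UU = ℤ-Solver.solve-∀
  gap-DD : ∀ a k → a ℤ.+ k ℤ.+ k ℤ.+ - 1ℤ ≡ (a ℤ.+ - 1ℤ) ℤ.+ k ℤ.+ k
  gap-DD = ℤ-Solver.solve-∀
  -- stated with 1ℤ ℤ.+ k because + suc g is definitionally 1ℤ ℤ.+ + g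
  gap-DU : ∀ a k → a ℤ.+ k ℤ.+ k ℤ.+ 1ℤ ≡ (a ℤ.+ - 1ℤ) ℤ.+ (1ℤ ℤ.+ k) ℤ.+ (1ℤ ℤ.+ k)
  gap-DU = ℤ-Solver.solve-∀
  gap-UD : ∀ a k → a ℤ.+ (1ℤ ℤ.+ k) ℤ.+ (1ℤ ℤ.+ k) ℤ.+ - 1ℤ ≡ (a ℤ.+ 1ℤ) ℤ.+ k ℤ.+ k
  gap-UD = ℤ-Solver.solve-∀
  gap-UD₀ : ∀ a → a ℤ.+ 1ℤ ≡ (a ℤ.+ 0ℤ ℤ.+ 0ℤ ℤ.+ - 1ℤ) ℤ.+ 1ℤ ℤ.+ 1ℤ
  gap-UD₀ = ℤ-Solver.solve-∀

pointwiseLeᵇ-heights : ∀ g a X Y →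
  pointwiseLeᵇ (heightsFrom a X) (heightsFrom (a ℤ.+ + g ℤ.+ + g) Y) ≡ belowᵇ g X Y
pointwiseLeᵇ-heights g a []      _       = refl
pointwiseLeᵇ-heights g a (U ∷ X) []      = refl
pointwiseLeᵇ-heights g a (D ∷ X) []      = refl
pointwiseLeᵇ-heights g a (U ∷ X) (U ∷ Y) rewrite gap-UU a (+ g) =
  ∧-true-head (≤ℤᵇ-gap (a ℤ.+ 1ℤ) g refl) (pointwiseLeᵇ-heights g (a ℤ.+ 1ℤ) X Y)
pointwiseLeᵇ-heights g a (D ∷ X) (D ∷ Y) rewrite gap-DD a (+ g) =
  ∧-true-head (≤ℤᵇ-gap (a ℤ.+ - 1ℤ) g refl) (pointwiseLeᵇ-heights g (a ℤ.+ - 1ℤ) X Y)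
pointwiseLeᵇ-heights g a (D ∷ X) (U ∷ Y) rewrite gap-DU a (+ g) =
  ∧-true-head (≤ℤᵇ-gap (a ℤ.+ - 1ℤ) (suc g) refl) (pointwiseLeᵇ-heights (suc g) (a ℤ.+ - 1ℤ) X Y)
pointwiseLeᵇ-heights zero a (U ∷ X) (D ∷ Y) =
  ∧-false-head (≰ℤᵇ-gap (a ℤ.+ 1ℤ) (a ℤ.+ 0ℤ ℤ.+ 0ℤ ℤ.+ - 1ℤ) (gap-UD₀ a))
pointwiseLeᵇ-heights (suc g) a (U ∷ X) (D ∷ Y) rewrite gap-UD a (+ g) =
  ∧-true-head (≤ℤᵇ-gap (a ℤ.+ 1ℤ) g refl) (pointwiseLeᵇ-heights g (a ℤ.+ 1ℤ) X Y)

#D : List Step → ℕ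
#D []      = 0
#D (U ∷ X) = #D X
#D (D ∷ X) = suc (#D X)

dPositionsFrom : ℕ → List Step → List ℕ
dPositionsFrom k []      = []
dPositionsFrom k (U ∷ X) = dPositionsFrom (suc k) X
dPositionsFrom k (D ∷ X) = k ∷ dPositionsFrom (suc k) X

dPositions : List Step → List ℕ
dPositions = dPositionsFrom 0

dPositionsFrom-suc : ∀ k X → dPositionsFrom (suc k) X ≡ map suc (dPositionsFrom k X)
dPositionsFrom-suc k []      = refl
dPositionsFrom-suc k (U ∷ X) = dPositionsFrom-suc (suc k) X
dPositionsFrom-suc k (D ∷ X) = cong (suc k ∷_) (dPositionsFrom-suc (suc k) X)

length-dPositionsFrom : ∀ k X → length (dPositionsFrom k X) ≡ #D X
length-dPositionsFrom k []      = refl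
length-dPositionsFrom k (U ∷ X) = length-dPositionsFrom (suc k) X
length-dPositionsFrom k (D ∷ X) = cong suc (length-dPositionsFrom (suc k) X)

private
  ≤*ᵇ-0∷ : ∀ g xs ys → (0 ∷ map suc xs) ≤*ᵇ map suc (drop g ys) ≡ xs ≤*ᵇ drop (suc g) ys
  ≤*ᵇ-0∷ zero    xs []       = sym (≤*ᵇ-[] xs)
  ≤*ᵇ-0∷ zero    xs (y ∷ ys) = ≤*ᵇ-map-suc xs ys
  ≤*ᵇ-0∷ (suc g) xs []       = sym (≤*ᵇ-[] xs)
  ≤*ᵇ-0∷ (suc g) xs (y ∷ ys) = ≤*ᵇ-0∷ g xs ys

  1+≰*ᵇ0∷ : ∀ {n} xs ys → length xs ≡ suc n → map suc xs ≤*ᵇ (0 ∷ ys) ≡ false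
  1+≰*ᵇ0∷ (x ∷ xs) ys _ = refl

belowᵇ-dPositions : ∀ g X Y → #D X + g ≡ #D Y → belowᵇ g X Y ≡ dPositions X ≤*ᵇ drop g (dPositions Y)
belowᵇ-dPositions g []      Y  _ = refl
belowᵇ-dPositions g (U ∷ X) [] _ rewrite drop-[] {A = ℕ} g = sym (≤*ᵇ-[] (dPositions (U ∷ X)))
belowᵇ-dPositions g (D ∷ X) [] _ rewrite drop-[] {A = ℕ} g = refl
belowᵇ-dPositions g (U ∷ X) (U ∷ Y) eq
  rewrite dPositionsFrom-suc 0 X | dPositionsFrom-suc 0 Y | drop-map {f = suc} g (dPositions Y)
        | ≤*ᵇ-map-suc (dPositions X) (drop g (dPositions Y))
  = belowᵇ-dPositions g X Y eq
belowᵇ-dPositions zero (D ∷ X) (D ∷ Y) eq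
  rewrite dPositionsFrom-suc 0 X | dPositionsFrom-suc 0 Y | ≤*ᵇ-map-suc (dPositions X) (dPositions Y)
  = belowᵇ-dPositions 0 X Y (suc-injective eq)
belowᵇ-dPositions (suc g) (D ∷ X) (D ∷ Y) eq
  rewrite dPositionsFrom-suc 0 X | dPositionsFrom-suc 0 Y | drop-map {f = suc} g (dPositions Y)
        | ≤*ᵇ-0∷ g (dPositions X) (dPositions Y)
  = belowᵇ-dPositions (suc g) X Y (suc-injective eq)
belowᵇ-dPositions g (D ∷ X) (U ∷ Y) eq
  rewrite dPositionsFrom-suc 0 X | dPositionsFrom-suc 0 Y | drop-map {f = suc} g (dPositions Y)
        | ≤*ᵇ-0∷ g (dPositions X) (dPositions Y)
  = belowᵇ-dPositions (suc g) X Y (trans (+-suc (#D X) g) eq)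
belowᵇ-dPositions zero (U ∷ X) (D ∷ Y) eq rewrite dPositionsFrom-suc 0 X =
  sym (1+≰*ᵇ0∷ (dPositions X) _ (trans (length-dPositionsFrom 0 X) (trans (sym (+-identityʳ (#D X))) eq)))
belowᵇ-dPositions (suc g) (U ∷ X) (D ∷ Y) eq
  rewrite dPositionsFrom-suc 0 X | dPositionsFrom-suc 0 Y | drop-map {f = suc} g (dPositions Y)
        | ≤*ᵇ-map-suc (dPositions X) (drop g (dPositions Y))
  = belowᵇ-dPositions g X Y (suc-injective (trans (sym (+-suc (#D X) g)) eq))

stanleyLeᵇ-dPositions : ∀ X Y → #D X ≡ #D Y → stanleyLeᵇ X Y ≡ dPositions X ≤*ᵇ dPositions Y
stanleyLeᵇ-dPositions X Y eq =
  trans (pointwiseLeᵇ-heights 0 0ℤ X Y) (belowᵇ-dPositions 0 X Y (trans (+-identityʳ (#D X)) eq))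

-- Block codes of 𝓕²

lengthIsᵇ⇔ : ∀ {A : Set} n (xs : List A) → lengthIsᵇ n xs ≡ true ⇔ length xs ≡ n
lengthIsᵇ⇔ zero    []       = mk⇔ (λ _ → refl) (λ _ → refl)
lengthIsᵇ⇔ zero    (x ∷ xs) = mk⇔ (λ ()) (λ ())
lengthIsᵇ⇔ (suc n) []       = mk⇔ (λ ()) (λ ())
lengthIsᵇ⇔ (suc n) (x ∷ xs) = mk⇔ (cong suc ∘ to) (from ∘ suc-injective)
  where open Equivalence (lengthIsᵇ⇔ n xs)

lengthIsᵇ-cong : ∀ {A B : Set} n (xs : List A) (ys : List B) → length xs ≡ length ys →
                 lengthIsᵇ n xs ≡ lengthIsᵇ n ys
lengthIsᵇ-cong zero    []       []       _  = refl
lengthIsᵇ-cong zero    (x ∷ xs) (y ∷ ys) _  = refl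
lengthIsᵇ-cong (suc n) []       []       _  = refl
lengthIsᵇ-cong (suc n) (x ∷ xs) (y ∷ ys) eq = lengthIsᵇ-cong n xs ys (suc-injective eq)

length-dyckFromᵇ : ∀ h X → dyckFromᵇ h X ≡ true → h + length X ≡ 2 * #D X
length-dyckFromᵇ zero    []      _ = refl
length-dyckFromᵇ zero    (U ∷ X) d = length-dyckFromᵇ 1 X d
length-dyckFromᵇ (suc h) (U ∷ X) d = trans (+-suc (suc h) (length X)) (length-dyckFromᵇ (suc (suc h)) X d)
length-dyckFromᵇ (suc h) (D ∷ X) d = trans (cong suc (+-suc h (length X)))
  (trans (cong (suc ∘ suc) (length-dyckFromᵇ h X d)) (sym (*-suc 2 (#D X))))

blocks : List Bool → List Step
blocks []          = []
blocks (true ∷ c)  = U ∷ D ∷ blocks c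
blocks (false ∷ c) = D ∷ blocks c

falses : List Bool → ℕ
falses []      = 0
falses (b ∷ c) = (if b then 0 else 1) + falses c

encode : List Bool → List Step
encode c = replicate (suc (falses c)) U ++ D ∷ blocks c

decodeBlocks : List Step → List Bool
decodeBlocks []          = []
decodeBlocks (D ∷ X)     = false ∷ decodeBlocks X
decodeBlocks (U ∷ D ∷ X) = true ∷ decodeBlocks X
decodeBlocks (U ∷ _)     = []

decode : List Step → List Bool
decode []      = []
decode (U ∷ X) = decode X
decode (D ∷ X) = decodeBlocks X

avoidsFFᵇ : List Bool → Bool
avoidsFFᵇ (x ∷ y ∷ c) = (x ∨ y) ∧ avoidsFFᵇ (y ∷ c)
avoidsFFᵇ _           = true

DUU DDD : List Step
DUU = D ∷ U ∷ U ∷ []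
DDD = D ∷ D ∷ D ∷ []

decode-replicate : ∀ k X → decode (replicate k U ++ X) ≡ decode X
decode-replicate zero    X = refl
decode-replicate (suc k) X = decode-replicate k X

decodeBlocks-blocks : ∀ c → decodeBlocks (blocks c) ≡ c
decodeBlocks-blocks []          = refl
decodeBlocks-blocks (true ∷ c)  = cong (true ∷_) (decodeBlocks-blocks c)
decodeBlocks-blocks (false ∷ c) = cong (false ∷_) (decodeBlocks-blocks c)

decode-encode : ∀ c → decode (encode c) ≡ c
decode-encode c = trans (decode-replicate (suc (falses c)) (D ∷ blocks c)) (decodeBlocks-blocks c)

#D-replicate : ∀ k X → #D (replicate k U ++ X) ≡ #D X
#D-replicate zero    X = refl
#D-replicate (suc k) X = #D-replicate k X

#D-blocks : ∀ c → #D (blocks c) ≡ length c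
#D-blocks []          = refl
#D-blocks (true ∷ c)  = cong suc (#D-blocks c)
#D-blocks (false ∷ c) = cong suc (#D-blocks c)

#D-encode : ∀ c → #D (encode c) ≡ suc (length c)
#D-encode c = trans (#D-replicate (suc (falses c)) (D ∷ blocks c)) (cong suc (#D-blocks c))

dyckFromᵇ-replicate : ∀ h k X → dyckFromᵇ h (replicate k U ++ X) ≡ dyckFromᵇ (k + h) X
dyckFromᵇ-replicate h       zero    X = refl
dyckFromᵇ-replicate zero    (suc k) X =
  trans (dyckFromᵇ-replicate 1 k X) (cong (λ h → dyckFromᵇ h X) (+-suc k 0))
dyckFromᵇ-replicate (suc h) (suc k) X =
  trans (dyckFromᵇ-replicate (suc (suc h)) k X) (cong (λ h → dyckFromᵇ h X) (+-suc k (suc h)))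

dyckFromᵇ-UD : ∀ h X → dyckFromᵇ h (U ∷ D ∷ X) ≡ dyckFromᵇ h X
dyckFromᵇ-UD zero    X = refl
dyckFromᵇ-UD (suc h) X = refl

dyckFromᵇ-blocks : ∀ c → dyckFromᵇ (falses c) (blocks c) ≡ true
dyckFromᵇ-blocks []          = refl
dyckFromᵇ-blocks (true ∷ c)  = trans (dyckFromᵇ-UD (falses c) (blocks c)) (dyckFromᵇ-blocks c)
dyckFromᵇ-blocks (false ∷ c) = dyckFromᵇ-blocks c

dyckFromᵇ-encode : ∀ c → dyckFromᵇ 0 (encode c) ≡ true
dyckFromᵇ-encode c = begin
  dyckFromᵇ 0 (encode c)
    ≡⟨ dyckFromᵇ-replicate 0 (suc (falses c)) (D ∷ blocks c) ⟩
  dyckFromᵇ (suc (falses c) + 0) (D ∷ blocks c)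
    ≡⟨ cong (λ h → dyckFromᵇ h (D ∷ blocks c)) (+-identityʳ (suc (falses c))) ⟩
  dyckFromᵇ (falses c) (blocks c)
    ≡⟨ dyckFromᵇ-blocks c ⟩
  true ∎
  where open ≡-Reasoning

length-encode : ∀ c → length (encode c) ≡ 2 * suc (length c)
length-encode c =
  trans (length-dyckFromᵇ 0 (encode c) (dyckFromᵇ-encode c)) (cong (2 *_) (#D-encode c))

lengthIsᵇ-encode : ∀ m c → lengthIsᵇ (2 * suc m) (encode c) ≡ lengthIsᵇ m c
lengthIsᵇ-encode m c =
  ⇔→≡ (⇔-sym (lengthIsᵇ⇔ m c) ⇔-∘ (length-encode⇔ ⇔-∘ lengthIsᵇ⇔ (2 * suc m) (encode c)))
  where
  length-encode⇔ : length (encode c) ≡ 2 * suc m ⇔ length c ≡ m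
  length-encode⇔ = mk⇔
    (λ eq → suc-injective (*-cancelˡ-≡ (suc (length c)) (suc m) 2 (trans (sym (length-encode c)) eq)))
    (λ eq → trans (length-encode c) (cong (λ l → 2 * suc l) eq))

occursᵇ-D∷-replicate : ∀ p k X →
  occursᵇ eqStep (D ∷ p) (replicate k U ++ X) ≡ occursᵇ eqStep (D ∷ p) X
occursᵇ-D∷-replicate p zero    X = refl
occursᵇ-D∷-replicate p (suc k) X = occursᵇ-D∷-replicate p k X

occursᵇ-DUU-blocks : ∀ c → occursᵇ eqStep DUU (D ∷ blocks c) ≡ false
occursᵇ-DUU-blocks []          = refl
occursᵇ-DUU-blocks (true ∷ c)  = occursᵇ-DUU-blocks c
occursᵇ-DUU-blocks (false ∷ c) = occursᵇ-DUU-blocks c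

occursᵇ-DDD-blocks : ∀ c → occursᵇ eqStep DDD (D ∷ blocks c) ≡ not (avoidsFFᵇ c)
occursᵇ-DDD-blocks []                  = refl
occursᵇ-DDD-blocks (true ∷ [])         = refl
occursᵇ-DDD-blocks (true ∷ b ∷ c)      = occursᵇ-DDD-blocks (b ∷ c)
occursᵇ-DDD-blocks (false ∷ [])        = refl
occursᵇ-DDD-blocks (false ∷ true ∷ c)  = occursᵇ-DDD-blocks (true ∷ c)
occursᵇ-DDD-blocks (false ∷ false ∷ c) = refl

avoidsAllᵇ-encode : ∀ c → avoidsAllᵇ eqStep (DUU ∷ DDD ∷ []) (encode c) ≡ avoidsFFᵇ c
avoidsAllᵇ-encode c
  rewrite occursᵇ-D∷-replicate (U ∷ U ∷ []) (suc (falses c)) (D ∷ blocks c) | occursᵇ-DUU-blocks c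
        | occursᵇ-D∷-replicate (D ∷ D ∷ []) (suc (falses c)) (D ∷ blocks c) | occursᵇ-DDD-blocks c
  = trans (∧-identityʳ _) (not-involutive (avoidsFFᵇ c))

isF2ᵇ-encode : ∀ m c → isF2ᵇ (suc m) (encode c) ≡ lengthIsᵇ m c ∧ avoidsFFᵇ c
isF2ᵇ-encode m c =
  cong₂ _∧_ (lengthIsᵇ-encode m c) (cong₂ _∧_ (dyckFromᵇ-encode c) (avoidsAllᵇ-encode c))

replicate-++-∷ : ∀ {A : Set} k (x : A) xs → replicate k x ++ x ∷ xs ≡ x ∷ replicate k x ++ xs
replicate-++-∷ zero    x xs = refl
replicate-++-∷ (suc k) x xs = cong (x ∷_) (replicate-++-∷ k x xs)

blocks-decodeBlocks : ∀ h X → dyckFromᵇ h X ≡ true → occursᵇ eqStep DUU (D ∷ X) ≡ false →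
                      blocks (decodeBlocks X) ≡ X × falses (decodeBlocks X) ≡ h
blocks-decodeBlocks zero    []          _ _ = refl , refl
blocks-decodeBlocks (suc h) (D ∷ X)     d o =
  let blocks≡ , falses≡ = blocks-decodeBlocks h X d o
  in cong (D ∷_) blocks≡ , cong suc falses≡
blocks-decodeBlocks h       (U ∷ D ∷ X) d o =
  let blocks≡ , falses≡ = blocks-decodeBlocks h X (trans (sym (dyckFromᵇ-UD h X)) d) o
  in cong (λ B → U ∷ D ∷ B) blocks≡ , falses≡
blocks-decodeBlocks (suc h) []          () _
blocks-decodeBlocks zero    (D ∷ X)     () _
blocks-decodeBlocks zero    (U ∷ [])    () _
blocks-decodeBlocks (suc h) (U ∷ [])    () _
blocks-decodeBlocks h       (U ∷ U ∷ X) _ ()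

encode-decode : ∀ h P → dyckFromᵇ (suc h) P ≡ true → occursᵇ eqStep DUU P ≡ false →
                encode (decode P) ≡ replicate (suc h) U ++ P
encode-decode h (U ∷ P) d o = trans (encode-decode (suc h) P d o) (sym (replicate-++-∷ (suc h) U P))
encode-decode h (D ∷ X) d o =
  let blocks≡ , falses≡ = blocks-decodeBlocks h X d o
  in cong₂ (λ k B → replicate (suc k) U ++ D ∷ B) falses≡ blocks≡
encode-decode h []      () _

isF2ᵇ-dyck-DUU : ∀ n P → T (isF2ᵇ n P) → dyckFromᵇ 0 P ≡ true × occursᵇ eqStep DUU P ≡ false
isF2ᵇ-dyck-DUU n P t =
  let _ , t₁ = T-∧⁻ (lengthIsᵇ (2 * n) P) t
      d , t₂ = T-∧⁻ (dyckFromᵇ 0 P) t₁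
      o , _  = T-∧⁻ (not (occursᵇ eqStep DUU P)) t₂
  in Equivalence.to T-≡ d , Equivalence.to T-not-≡ o

encode-decode-F2 : ∀ m P → T (isF2ᵇ (suc m) P) → encode (decode P) ≡ P
encode-decode-F2 m (U ∷ P) P∈F2 = let d , o = isF2ᵇ-dyck-DUU (suc m) (U ∷ P) P∈F2 in encode-decode 0 P d o
encode-decode-F2 m (D ∷ P) P∈F2 with () ← proj₁ (isF2ᵇ-dyck-DUU (suc m) (D ∷ P) P∈F2)
encode-decode-F2 m []      ()

length-decode-F2 : ∀ m P → T (isF2ᵇ (suc m) P) → length (decode P) ≡ m
length-decode-F2 m P P∈F2 = Equivalence.to (lengthIsᵇ⇔ m (decode P))
  (Equivalence.to T-≡ (proj₁ (T-∧⁻ (lengthIsᵇ m (decode P)) (subst T isF2ᵇ≡ P∈F2))))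
  where
  isF2ᵇ≡ : isF2ᵇ (suc m) P ≡ lengthIsᵇ m (decode P) ∧ avoidsFFᵇ (decode P)
  isF2ᵇ≡ = trans (cong (isF2ᵇ (suc m)) (sym (encode-decode-F2 m P P∈F2))) (isF2ᵇ-encode m (decode P))

suffixFalses : List Bool → List ℕ
suffixFalses []      = 0 ∷ []
suffixFalses (b ∷ c) = falses (b ∷ c) ∷ suffixFalses c

stagger : ℕ → List ℕ → List ℕ
stagger k []       = []
stagger k (x ∷ xs) = k + x ∷ stagger (2 + k) xs

≤*ᵇ-stagger : ∀ k xs ys → stagger k xs ≤*ᵇ stagger k ys ≡ xs ≤*ᵇ ys
≤*ᵇ-stagger k []       ys       = refl
≤*ᵇ-stagger k (x ∷ xs) []       = refl
≤*ᵇ-stagger k (x ∷ xs) (y ∷ ys) = cong₂ _∧_ (≤ᵇ-+ˡ k x y) (≤*ᵇ-stagger (2 + k) xs ys)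

dPositionsFrom-replicate : ∀ k j X → dPositionsFrom k (replicate j U ++ X) ≡ dPositionsFrom (k + j) X
dPositionsFrom-replicate k zero    X = cong (λ i → dPositionsFrom i X) (sym (+-identityʳ k))
dPositionsFrom-replicate k (suc j) X =
  trans (dPositionsFrom-replicate (suc k) j X) (cong (λ i → dPositionsFrom i X) (sym (+-suc k j)))

dPositionsFrom-blocks : ∀ j c → dPositionsFrom (j + falses c) (D ∷ blocks c) ≡ stagger j (suffixFalses c)
dPositionsFrom-blocks j []          = refl
dPositionsFrom-blocks j (true ∷ c)  = cong (j + falses c ∷_) (dPositionsFrom-blocks (2 + j) c)
dPositionsFrom-blocks j (false ∷ c) = cong (j + suc (falses c) ∷_)
  (trans (cong (λ i → dPositionsFrom (suc i) (D ∷ blocks c)) (+-suc j (falses c)))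
         (dPositionsFrom-blocks (2 + j) c))

dPositions-encode : ∀ c → dPositions (encode c) ≡ stagger 1 (suffixFalses c)
dPositions-encode c =
  trans (dPositionsFrom-replicate 0 (suc (falses c)) (D ∷ blocks c)) (dPositionsFrom-blocks 1 c)

stanleyLeᵇ-encode : ∀ c d → length c ≡ length d →
                    stanleyLeᵇ (encode c) (encode d) ≡ suffixFalses c ≤*ᵇ suffixFalses d
stanleyLeᵇ-encode c d eq = begin
  stanleyLeᵇ (encode c) (encode d)
    ≡⟨ stanleyLeᵇ-dPositions (encode c) (encode d) #D≡ ⟩
  dPositions (encode c) ≤*ᵇ dPositions (encode d)
    ≡⟨ cong₂ _≤*ᵇ_ (dPositions-encode c) (dPositions-encode d) ⟩
  stagger 1 (suffixFalses c) ≤*ᵇ stagger 1 (suffixFalses d)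
    ≡⟨ ≤*ᵇ-stagger 1 (suffixFalses c) (suffixFalses d) ⟩
  suffixFalses c ≤*ᵇ suffixFalses d ∎
  where
  open ≡-Reasoning
  #D≡ : #D (encode c) ≡ #D (encode d)
  #D≡ = trans (#D-encode c) (trans (cong suc eq) (sym (#D-encode d)))

-- Motzkin paths as pairs of codes

bits : MStep → Bool × Bool
bits MU = true  , false
bits MD = false , true
bits F₁ = true  , true
bits F₂ = false , false

mstep : Bool → Bool → MStep
mstep true  false = MU
mstep false true  = MD
mstep true  true  = F₁
mstep false false = F₂

bits-mstep : ∀ ab → bits (uncurry′ mstep ab) ≡ ab
bits-mstep (true  , true)  = refl
bits-mstep (true  , false) = refl
bits-mstep (false , true)  = refl
bits-mstep (false , false) = refl

mstep-bits : ∀ x → uncurry′ mstep (bits x) ≡ x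
mstep-bits MU = refl
mstep-bits MD = refl
mstep-bits F₁ = refl
mstep-bits F₂ = refl

lowerBits upperBits : List MStep → List Bool
lowerBits = proj₁ ∘ unzipWith bits
upperBits = proj₂ ∘ unzipWith bits

lowerCode upperCode : List MStep → List Bool
lowerCode = reverse ∘ lowerBits
upperCode = reverse ∘ upperBits

motzOfCodes : List Bool → List Bool → List MStep
motzOfCodes c d = zipWith mstep (reverse c) (reverse d)

motzOfCodes-codes : ∀ w → motzOfCodes (lowerCode w) (upperCode w) ≡ w
motzOfCodes-codes w = begin
  zipWith mstep (reverse (lowerCode w)) (reverse (upperCode w))
    ≡⟨ cong₂ (zipWith mstep) (reverse-involutive (lowerBits w)) (reverse-involutive (upperBits w)) ⟩
  zipWith mstep (lowerBits w) (upperBits w)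
    ≡⟨ zipWith-unzipWith bits mstep mstep-bits w ⟩
  w ∎
  where open ≡-Reasoning

codes-motzOfCodes : ∀ c d → length c ≡ length d →
                    lowerCode (motzOfCodes c d) ≡ c × upperCode (motzOfCodes c d) ≡ d
codes-motzOfCodes c d eq =
  trans (cong (reverse ∘ proj₁) unzip≡) (reverse-involutive c) ,
  trans (cong (reverse ∘ proj₂) unzip≡) (reverse-involutive d)
  where
  unzip≡ : unzipWith bits (motzOfCodes c d) ≡ (reverse c , reverse d)
  unzip≡ = unzipWith-zipWith bits mstep bits-mstep (reverse c) (reverse d)
             (trans (length-reverse c) (trans eq (sym (length-reverse d))))

prefixFalsesFrom : ℕ → List Bool → List ℕ
prefixFalsesFrom a []      = a ∷ []
prefixFalsesFrom a (b ∷ s) = a ∷ prefixFalsesFrom ((if b then 0 else 1) + a) s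

length-prefixFalsesFrom : ∀ a s → length (prefixFalsesFrom a s) ≡ suc (length s)
length-prefixFalsesFrom a []      = refl
length-prefixFalsesFrom a (b ∷ s) = cong suc (length-prefixFalsesFrom _ s)

suffixFalses-∷ : ∀ c → falses c ∷ drop 1 (suffixFalses c) ≡ suffixFalses c
suffixFalses-∷ []      = refl
suffixFalses-∷ (_ ∷ _) = refl

suffixFalses-ʳ++ : ∀ p c →
  suffixFalses (p ʳ++ c) ≡ prefixFalsesFrom (falses c) p ʳ++ drop 1 (suffixFalses c)
suffixFalses-ʳ++ []      c = sym (suffixFalses-∷ c)
suffixFalses-ʳ++ (b ∷ p) c = trans (suffixFalses-ʳ++ p (b ∷ c))
  (cong (prefixFalsesFrom (falses (b ∷ c)) p ʳ++_) (sym (suffixFalses-∷ c)))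

suffixFalses-reverse : ∀ s → suffixFalses (reverse s) ≡ reverse (prefixFalsesFrom 0 s)
suffixFalses-reverse s = suffixFalses-ʳ++ s []

prefixFalsesFrom-≰ : ∀ {x y} s t → x ≤ᵇ y ≡ false → prefixFalsesFrom x s ≤*ᵇ prefixFalsesFrom y t ≡ false
prefixFalsesFrom-≰ []      []      x≰y = ∧-false-head x≰y
prefixFalsesFrom-≰ []      (_ ∷ _) x≰y = ∧-false-head x≰y
prefixFalsesFrom-≰ (_ ∷ _) []      x≰y = ∧-false-head x≰y
prefixFalsesFrom-≰ (_ ∷ _) (_ ∷ _) x≰y = ∧-false-head x≰y

-- After each prefix, the height of a Motzkin path started at h is h plus the number of false upper
-- bits minus the number of false lower bits.
motzFromᵇ-prefixFalses : ∀ h a w →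
  prefixFalsesFrom a (lowerBits w) ≤*ᵇ prefixFalsesFrom (h + a) (upperBits w) ≡ motzFromᵇ h w
motzFromᵇ-prefixFalses h       a []       = ∧-true-head (m≤ᵇk+m h a) refl
motzFromᵇ-prefixFalses h       a (MU ∷ w) = ∧-true-head (m≤ᵇk+m h a) (motzFromᵇ-prefixFalses (suc h) a w)
motzFromᵇ-prefixFalses zero    a (MD ∷ w) =
  ∧-true-head (m≤ᵇk+m 0 a) (prefixFalsesFrom-≰ (lowerBits w) (upperBits w) (1+n≰ᵇn a))
motzFromᵇ-prefixFalses (suc h) a (MD ∷ w) = ∧-true-head (m≤ᵇk+m (suc h) a)
  (trans (cong (λ b → prefixFalsesFrom (suc a) (lowerBits w) ≤*ᵇ prefixFalsesFrom b (upperBits w))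
               (sym (+-suc h a)))
         (motzFromᵇ-prefixFalses h (suc a) w))
motzFromᵇ-prefixFalses h       a (F₁ ∷ w) = ∧-true-head (m≤ᵇk+m h a) (motzFromᵇ-prefixFalses h a w)
motzFromᵇ-prefixFalses h       a (F₂ ∷ w) = ∧-true-head (m≤ᵇk+m h a)
  (trans (cong (λ b → prefixFalsesFrom (suc a) (lowerBits w) ≤*ᵇ prefixFalsesFrom b (upperBits w))
               (sym (+-suc h a)))
         (motzFromᵇ-prefixFalses h (suc a) w))

stanleyLeᵇ-codes : ∀ w → stanleyLeᵇ (encode (lowerCode w)) (encode (upperCode w)) ≡ motzFromᵇ 0 w
stanleyLeᵇ-codes w = begin
  stanleyLeᵇ (encode (lowerCode w)) (encode (upperCode w))
    ≡⟨ stanleyLeᵇ-encode (lowerCode w) (upperCode w) codes≡ ⟩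
  suffixFalses (lowerCode w) ≤*ᵇ suffixFalses (upperCode w)
    ≡⟨ cong₂ _≤*ᵇ_ (suffixFalses-reverse (lowerBits w)) (suffixFalses-reverse (upperBits w)) ⟩
  reverse lower ≤*ᵇ reverse upper
    ≡⟨ ≤*ᵇ-reverse lower upper prefixes≡ ⟩
  lower ≤*ᵇ upper
    ≡⟨ motzFromᵇ-prefixFalses 0 0 w ⟩
  motzFromᵇ 0 w ∎
  where
  open ≡-Reasoning
  lower = prefixFalsesFrom 0 (lowerBits w)
  upper = prefixFalsesFrom 0 (upperBits w)
  bits≡ : length (lowerBits w) ≡ length (upperBits w)
  bits≡ = trans (length-unzipWith₁ bits w) (sym (length-unzipWith₂ bits w))
  codes≡ : length (lowerCode w) ≡ length (upperCode w)
  codes≡ = trans (length-reverse (lowerBits w)) (trans bits≡ (sym (length-reverse (upperBits w))))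
  prefixes≡ : length lower ≡ length upper
  prefixes≡ = trans (length-prefixFalsesFrom 0 (lowerBits w))
                    (trans (cong suc bits≡) (sym (length-prefixFalsesFrom 0 (upperBits w))))

avoidsFFᵇ-ʳ++ : ∀ xs y ys → avoidsFFᵇ (xs ʳ++ y ∷ ys) ≡ avoidsFFᵇ (y ∷ xs) ∧ avoidsFFᵇ (y ∷ ys)
avoidsFFᵇ-ʳ++ []       y ys = refl
avoidsFFᵇ-ʳ++ (x ∷ xs) y ys = begin
  avoidsFFᵇ (xs ʳ++ x ∷ y ∷ ys)
    ≡⟨ avoidsFFᵇ-ʳ++ xs x (y ∷ ys) ⟩
  avoidsFFᵇ (x ∷ xs) ∧ ((x ∨ y) ∧ avoidsFFᵇ (y ∷ ys))
    ≡⟨ sym (∧-assoc (avoidsFFᵇ (x ∷ xs)) (x ∨ y) _) ⟩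
  (avoidsFFᵇ (x ∷ xs) ∧ (x ∨ y)) ∧ avoidsFFᵇ (y ∷ ys)
    ≡⟨ cong (_∧ avoidsFFᵇ (y ∷ ys)) (∧-comm (avoidsFFᵇ (x ∷ xs)) (x ∨ y)) ⟩
  ((x ∨ y) ∧ avoidsFFᵇ (x ∷ xs)) ∧ avoidsFFᵇ (y ∷ ys)
    ≡⟨ cong (λ b → (b ∧ avoidsFFᵇ (x ∷ xs)) ∧ avoidsFFᵇ (y ∷ ys)) (∨-comm x y) ⟩
  avoidsFFᵇ (y ∷ x ∷ xs) ∧ avoidsFFᵇ (y ∷ ys) ∎
  where open ≡-Reasoning

avoidsFFᵇ-reverse : ∀ xs → avoidsFFᵇ (reverse xs) ≡ avoidsFFᵇ xs
avoidsFFᵇ-reverse []       = refl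
avoidsFFᵇ-reverse (x ∷ xs) = trans (avoidsFFᵇ-ʳ++ xs x []) (∧-identityʳ (avoidsFFᵇ (x ∷ xs)))

avoidsAllᵇ-∷ : ∀ {A : Set} (eq : A → A → Bool) ps x w →
  avoidsAllᵇ eq ps (x ∷ w) ≡ all (λ p → not (isPrefixᵇ eq p (x ∷ w))) ps ∧ avoidsAllᵇ eq ps w
avoidsAllᵇ-∷ eq []       x w = refl
avoidsAllᵇ-∷ eq (p ∷ ps) x w = trans
  (cong₂ _∧_ (deMorgan₂ (isPrefixᵇ eq p (x ∷ w)) (occursᵇ eq p w)) (avoidsAllᵇ-∷ eq ps x w))
  (∧-interchange (not (isPrefixᵇ eq p (x ∷ w))) (not (occursᵇ eq p w)) _ _)

-- The seven patterns are exactly the pairs of steps whose lower bits, or whose upper bits, are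
-- both false.
motzPatterns-prefix : ∀ x y w → all (λ p → not (isPrefixᵇ eqMStep p (x ∷ y ∷ w))) motzPatterns
                              ≡ (proj₁ (bits x) ∨ proj₁ (bits y)) ∧ (proj₂ (bits x) ∨ proj₂ (bits y))
motzPatterns-prefix MU MU _ = refl
motzPatterns-prefix MU MD _ = refl
motzPatterns-prefix MU F₁ _ = refl
motzPatterns-prefix MU F₂ _ = refl
motzPatterns-prefix MD MU _ = refl
motzPatterns-prefix MD MD _ = refl
motzPatterns-prefix MD F₁ _ = refl
motzPatterns-prefix MD F₂ _ = refl
motzPatterns-prefix F₁ MU _ = refl
motzPatterns-prefix F₁ MD _ = refl
motzPatterns-prefix F₁ F₁ _ = refl
motzPatterns-prefix F₁ F₂ _ = refl
motzPatterns-prefix F₂ MU _ = refl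
motzPatterns-prefix F₂ MD _ = refl
motzPatterns-prefix F₂ F₁ _ = refl
motzPatterns-prefix F₂ F₂ _ = refl

avoidsAllᵇ-motzPatterns : ∀ w →
  avoidsAllᵇ eqMStep motzPatterns w ≡ avoidsFFᵇ (lowerBits w) ∧ avoidsFFᵇ (upperBits w)
avoidsAllᵇ-motzPatterns []          = refl
avoidsAllᵇ-motzPatterns (MU ∷ [])   = refl
avoidsAllᵇ-motzPatterns (MD ∷ [])   = refl
avoidsAllᵇ-motzPatterns (F₁ ∷ [])   = refl
avoidsAllᵇ-motzPatterns (F₂ ∷ [])   = refl
avoidsAllᵇ-motzPatterns (x ∷ y ∷ w) = begin
  avoidsAllᵇ eqMStep motzPatterns (x ∷ y ∷ w)
    ≡⟨ avoidsAllᵇ-∷ eqMStep motzPatterns x (y ∷ w) ⟩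
  noPrefix ∧ avoidsAllᵇ eqMStep motzPatterns (y ∷ w)
    ≡⟨ cong₂ _∧_ (motzPatterns-prefix x y w) (avoidsAllᵇ-motzPatterns (y ∷ w)) ⟩
  (lowerOk ∧ upperOk) ∧ (avoidsFFᵇ (lowerBits (y ∷ w)) ∧ avoidsFFᵇ (upperBits (y ∷ w)))
    ≡⟨ ∧-interchange lowerOk upperOk _ _ ⟩
  avoidsFFᵇ (lowerBits (x ∷ y ∷ w)) ∧ avoidsFFᵇ (upperBits (x ∷ y ∷ w)) ∎
  where
  open ≡-Reasoning
  noPrefix = all (λ p → not (isPrefixᵇ eqMStep p (x ∷ y ∷ w))) motzPatterns
  lowerOk  = proj₁ (bits x) ∨ proj₁ (bits y)
  upperOk  = proj₂ (bits x) ∨ proj₂ (bits y)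

isIntervalᵇ : ℕ → List Step × List Step → Bool
isIntervalᵇ n (P , Q) = isF2ᵇ n P ∧ isF2ᵇ n Q ∧ stanleyLeᵇ P Q

pathsOf : List MStep → List Step × List Step
pathsOf w = encode (lowerCode w) , encode (upperCode w)

motzOf : List Step × List Step → List MStep
motzOf (P , Q) = motzOfCodes (decode P) (decode Q)

isF2ᵇ-encode-reverse : ∀ m bs → isF2ᵇ (suc m) (encode (reverse bs)) ≡ lengthIsᵇ m bs ∧ avoidsFFᵇ bs
isF2ᵇ-encode-reverse m bs = trans (isF2ᵇ-encode m (reverse bs))
  (cong₂ _∧_ (lengthIsᵇ-cong m (reverse bs) bs (length-reverse bs)) (avoidsFFᵇ-reverse bs))

private
  ∧-rearrange : ∀ l s t o → (l ∧ s) ∧ (l ∧ t) ∧ o ≡ l ∧ o ∧ s ∧ t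
  ∧-rearrange false s     t o = refl
  ∧-rearrange true  false t o = sym (∧-zeroʳ o)
  ∧-rearrange true  true  t o = ∧-comm t o

isIntervalᵇ-pathsOf : ∀ m w → isIntervalᵇ (suc m) (pathsOf w) ≡ isMotzᵇ m w
isIntervalᵇ-pathsOf m w = begin
  isIntervalᵇ (suc m) (pathsOf w)
    ≡⟨ cong₂ _∧_ (isF2ᵇ-encode-reverse m lower)
                 (cong₂ _∧_ (isF2ᵇ-encode-reverse m upper) (stanleyLeᵇ-codes w)) ⟩
  (lengthIsᵇ m lower ∧ avoidsFFᵇ lower) ∧ (lengthIsᵇ m upper ∧ avoidsFFᵇ upper) ∧ motzFromᵇ 0 w
    ≡⟨ cong₂ (λ l l′ → (l ∧ avoidsFFᵇ lower) ∧ (l′ ∧ avoidsFFᵇ upper) ∧ motzFromᵇ 0 w)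
             (lengthIsᵇ-cong m lower w (length-unzipWith₁ bits w))
             (lengthIsᵇ-cong m upper w (length-unzipWith₂ bits w)) ⟩
  (lengthIsᵇ m w ∧ avoidsFFᵇ lower) ∧ (lengthIsᵇ m w ∧ avoidsFFᵇ upper) ∧ motzFromᵇ 0 w
    ≡⟨ ∧-rearrange (lengthIsᵇ m w) (avoidsFFᵇ lower) (avoidsFFᵇ upper) (motzFromᵇ 0 w) ⟩
  lengthIsᵇ m w ∧ motzFromᵇ 0 w ∧ avoidsFFᵇ lower ∧ avoidsFFᵇ upper
    ≡⟨ cong (λ a → lengthIsᵇ m w ∧ motzFromᵇ 0 w ∧ a) (sym (avoidsAllᵇ-motzPatterns w)) ⟩
  isMotzᵇ m w ∎
  where
  open ≡-Reasoning
  lower = lowerBits w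
  upper = upperBits w

motzOf-pathsOf : ∀ w → motzOf (pathsOf w) ≡ w
motzOf-pathsOf w = trans (cong₂ motzOfCodes (decode-encode (lowerCode w)) (decode-encode (upperCode w)))
                         (motzOfCodes-codes w)

pathsOf-motzOf : ∀ m PQ → T (isIntervalᵇ (suc m) PQ) → pathsOf (motzOf PQ) ≡ PQ
pathsOf-motzOf m (P , Q) t = cong₂ _,_
  (trans (cong encode (proj₁ codes≡)) (encode-decode-F2 m P P∈F2))
  (trans (cong encode (proj₂ codes≡)) (encode-decode-F2 m Q Q∈F2))
  where
  P∈F2 = proj₁ (T-∧⁻ (isF2ᵇ (suc m) P) t)
  Q∈F2 = proj₁ (T-∧⁻ (isF2ᵇ (suc m) Q) (proj₂ (T-∧⁻ (isF2ᵇ (suc m) P) t)))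
  codes≡ = codes-motzOfCodes (decode P) (decode Q)
             (trans (length-decode-F2 m P P∈F2) (sym (length-decode-F2 m Q Q∈F2)))

Σ-T-≡ : ∀ {A : Set} {p : A → Bool} {a a′ : A} {pa : T (p a)} {pa′ : T (p a′)} →
        a ≡ a′ → _≡_ {A = Σ A (T ∘ p)} (a , pa) (a′ , pa′)
Σ-T-≡ {pa = pa} {pa′} refl = cong (_ ,_) (T-irrelevant pa pa′)

mk↔-subset : ∀ {A B : Set} {p : A → Bool} {q : B → Bool} (f : A → B) (g : B → A) →
             (∀ a → q (f a) ≡ p a) → (∀ a → g (f a) ≡ a) → (∀ b → T (q b) → f (g b) ≡ b) →
             Σ A (T ∘ p) ↔ Σ B (T ∘ q)
mk↔-subset {A = A} {B} {p} {q} f g q∘f≡p g∘f≡id f∘g≡id = mk↔ₛ′ to from to∘from from∘to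
  where
  to : Σ A (T ∘ p) → Σ B (T ∘ q)
  to (a , pa) = f a , subst T (sym (q∘f≡p a)) pa
  from : Σ B (T ∘ q) → Σ A (T ∘ p)
  from (b , qb) = g b , subst T (q∘f≡p (g b)) (subst (T ∘ q) (sym (f∘g≡id b qb)) qb)
  to∘from : ∀ y → to (from y) ≡ y
  to∘from (b , qb) = Σ-T-≡ (f∘g≡id b qb)
  from∘to : ∀ x → from (to x) ≡ x
  from∘to (a , _) = Σ-T-≡ (g∘f≡id a)

Interval-↔ : ∀ n → Interval n ↔ Σ (List Step × List Step) (T ∘ isIntervalᵇ n)
Interval-↔ n = mk↔ₛ′ to from to∘from from∘to
  where
  to : Interval n → Σ (List Step × List Step) (T ∘ isIntervalᵇ n)
  to (((P , P∈F2) , (Q , Q∈F2)) , P≤Q) =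
    (P , Q) , Equivalence.from T-∧ (P∈F2 , Equivalence.from T-∧ (Q∈F2 , P≤Q))
  from : Σ (List Step × List Step) (T ∘ isIntervalᵇ n) → Interval n
  from ((P , Q) , t) = let P∈F2 , t′  = T-∧⁻ (isF2ᵇ n P) t
                           Q∈F2 , P≤Q = T-∧⁻ (isF2ᵇ n Q) t′
                       in ((P , P∈F2) , (Q , Q∈F2)) , P≤Q
  to∘from : ∀ y → to (from y) ≡ y
  to∘from _ = Σ-T-≡ refl
  from∘to : ∀ x → from (to x) ≡ x
  from∘to (((P , P∈F2) , (Q , Q∈F2)) , P≤Q) = proofs-irrelevant
    where
    proofs-irrelevant : ∀ {P∈F2′ Q∈F2′ P≤Q′} →
      _≡_ {A = Interval n} (((P , P∈F2′) , (Q , Q∈F2′)) , P≤Q′) (((P , P∈F2) , (Q , Q∈F2)) , P≤Q)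
    proofs-irrelevant {P∈F2′} {Q∈F2′} {P≤Q′}
      with refl ← T-irrelevant P∈F2′ P∈F2 | refl ← T-irrelevant Q∈F2′ Q∈F2
      = cong (_ ,_) (T-irrelevant P≤Q′ P≤Q)

Motz-↔ : ∀ m → Motz m ↔ Σ (List Step × List Step) (T ∘ isIntervalᵇ (suc m))
Motz-↔ m = mk↔-subset pathsOf motzOf (isIntervalᵇ-pathsOf m) motzOf-pathsOf (pathsOf-motzOf m)

theorem4p6 : (n : ℕ) → 1 ≤ n → Interval n ⤖ Motz (n ∸ 1)
theorem4p6 (suc m) _ = ↔⇒⤖ (↔-trans (Interval-↔ (suc m)) (↔-sym (Motz-↔ m)))
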